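{- There is an fpt-reduction from the parameterized problem Small-Unsatisfiable-Subset (over all CNF formulas) to the parameterized problem Local-Backbone (over all CNF formulas).
   Context: A literal is a propositional variable $x$ or its negation $\neg x$. A clause is a finite set of literals not containing a complementary pair $x,\neg x$; a CNF formula is a finite set of clauses, and $|\varphi|$ denotes its number of clauses. $\mathrm{Var}(\varphi)$ is the set of variables occurring (positively or negatively) in $\varphi$. An assignment satisfies $\varphi$ if every clause contains a literal made true by it. For formulas $\varphi,\psi$, $\varphi\models\psi$ means every assignment satisfying $\varphi$ also satisfies $\psi$. For an integer $k$, a variable $x$ is a $k$-backbone of $\varphi$ if there is $\varphi'\subseteq\varphi$ with $|\varphi'|\le k$ such that $\varphi'\models x$ or $\varphi'\models\neg x$. Local-Backbone: instance $(\varphi,x,k)$ with $\varphi$ a CNF formula, $x$ a variable of $\varphi$, $k\ge1$ an integer; parameter $k$; question: is $x$ a $k$-backbone of $\varphi$? Small-Unsatisfiable-Subset: instance $(\varphi,k)$ with $\varphi$ a CNF formula and $k\ge 1$; parameter $k$; question: is there an unsatisfiable $\varphi'\subseteq\varphi$ with $|\varphi'|\le k$? An fpt-reduction from parameterized problem $L$ to parameterized problem $L'$ is a mapping $R$ from instances $(I,k)$ of $L$ to instances $(I',k')=R(I,k)$ of $L'$ such that $(I,k)\in L$ iff $(I',k')\in L'$, $k'\le g(k)$ for a computable function $g$, and $R$ is computable in time $O(f(k)|I|^c)$ for a computable $f$ and constant $c$. -}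

module Defs where

open import Data.Nat using (ℕ; zero; suc; _+_; _*_; _^_; _≤_)
open import Data.Nat.Binary as B using (ℕᵇ; 2[1+_]; 1+[2_])
open import Data.Bool using (Bool; true; false)
open import Data.Fin using (Fin)
open import Data.List using (List; []; _∷_; _++_; length; map; concatMap; [_])
open import Data.List.Relation.Unary.All using (All)
open import Data.List.Relation.Unary.Any using (Any)
open import Data.List.Membership.Propositional using (_∈_)
open import Data.Maybe using (Maybe; just; nothing)
open import Data.Product using (Σ; _×_; _,_; ∃)
open import Data.Sum using (_⊎_; inj₁; inj₂)
open import Relation.Binary.PropositionalEquality using (_≡_)
open import Relation.Nullary using (¬_)
open import Function.Bundles using (_⇔_)

data Literal : Set where
  pos : ℕ → Literal
  neg : ℕ → Literal

Clause : Set
Clause = List Literal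

-- a CNF formula is a finite set of clauses, represented by a list
CNF : Set
CNF = List Clause

ClauseWF : Clause → Set
ClauseWF C = ∀ x → ¬ (pos x ∈ C × neg x ∈ C)

CNFWF : CNF → Set
CNFWF φ = All ClauseWF φ

VarOf : ℕ → CNF → Set
VarOf x φ = Any (λ C → pos x ∈ C ⊎ neg x ∈ C) φ

Assignment : Set
Assignment = ℕ → Bool

LitTrue : Assignment → Literal → Set
LitTrue a (pos x) = a x ≡ true
LitTrue a (neg x) = a x ≡ false

Satisfies : Assignment → CNF → Set
Satisfies a φ = All (λ C → Any (LitTrue a) C) φ

Unsatisfiable : CNF → Set
Unsatisfiable φ = ∀ a → ¬ Satisfies a φ

EntailsPos : CNF → ℕ → Set
EntailsPos φ x = ∀ a → Satisfies a φ → a x ≡ true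

EntailsNeg : CNF → ℕ → Set
EntailsNeg φ x = ∀ a → Satisfies a φ → a x ≡ false

SmallSubset : ℕ → CNF → CNF → Set
SmallSubset k φ φ' = All (_∈ φ) φ' × length φ' ≤ k

IsKBackbone : CNF → ℕ → ℕ → Set
IsKBackbone φ x k =
  Σ CNF λ φ' → SmallSubset k φ φ' × (EntailsPos φ' x ⊎ EntailsNeg φ' x)

HasSmallUnsatSubset : CNF → ℕ → Set
HasSmallUnsatSubset φ k = Σ CNF λ φ' → SmallSubset k φ φ' × Unsatisfiable φ'

data Sym : Set where
  b0 b1 litEnd clauseEnd fieldEnd : Sym

-- binary digits of a natural number (least significant first)
bitsᵇ : ℕᵇ → List Sym
bitsᵇ B.zero   = []
bitsᵇ 2[1+ n ] = b0 ∷ bitsᵇ n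
bitsᵇ 1+[2 n ] = b1 ∷ bitsᵇ n
-- (the structural code of ℕᵇ: injective, of logarithmic length; any
--  such code is polynomially equivalent)

encNat : ℕ → List Sym
encNat n = bitsᵇ (B.fromℕ n)

encLit : Literal → List Sym
encLit (pos x) = b1 ∷ encNat x ++ [ litEnd ]
encLit (neg x) = b0 ∷ encNat x ++ [ litEnd ]

encClause : Clause → List Sym
encClause C = concatMap encLit C ++ [ clauseEnd ]

encCNF : CNF → List Sym
encCNF φ = concatMap encClause φ

record ParamProblem : Set₁ where
  field
    Instance : Set
    Valid    : Instance → Set
    param    : Instance → ℕ
    encode   : Instance → List Sym
    Yes      : Instance → Set

SUS : ParamProblem
SUS = record
  { Instance = CNF × ℕ
  ; Valid    = λ { (φ , k) → CNFWF φ × 1 ≤ k }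
  ; param    = λ { (φ , k) → k }
  ; encode   = λ { (φ , k) → encCNF φ ++ fieldEnd ∷ encNat k }
  ; Yes      = λ { (φ , k) → HasSmallUnsatSubset φ k }
  }

LocalBackbone : ParamProblem
LocalBackbone = record
  { Instance = CNF × ℕ × ℕ
  ; Valid    = λ { (φ , x , k) → CNFWF φ × VarOf x φ × 1 ≤ k }
  ; param    = λ { (φ , x , k) → k }
  ; encode   = λ { (φ , x , k) →
                   encCNF φ ++ fieldEnd ∷ encNat x ++ fieldEnd ∷ encNat k }
  ; Yes      = λ { (φ , x , k) → IsKBackbone φ x k }
  }

-- tape alphabet: blank (nothing), input symbols, m extra work symbols
Γ : ℕ → Set
Γ m = Maybe (Sym ⊎ Fin m)

data Move : Set where
  L R S : Move

record TM (m q : ℕ) : Set where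
  field
    start : Fin q
    -- nothing = halt
    δ     : Fin q → Γ m → Maybe (Fin q × Γ m × Move)

record Config (m q : ℕ) : Set where
  constructor cfg
  field
    state : Fin q
    left  : List (Γ m)   -- cells left of the head, nearest first
    head  : Γ m
    right : List (Γ m)   -- cells right of the head, nearest first
-- cells beyond the lists are blank

module _ {m q : ℕ} (M : TM m q) where
  open TM M

  moveHead : Move → List (Γ m) → Γ m → List (Γ m) → Fin q → Config m q
  moveHead L []       h r s = cfg s [] nothing (h ∷ r)
  moveHead L (l ∷ ls) h r s = cfg s ls l (h ∷ r)
  moveHead R ls h []       s = cfg s (h ∷ ls) nothing []
  moveHead R ls h (x ∷ r) s = cfg s (h ∷ ls) x r
  moveHead S ls h r        s = cfg s ls h r

  step : Config m q → Maybe (Config m q)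
  step (cfg s l h r) with δ s h
  ... | nothing              = nothing
  ... | just (s' , w , mv)   = just (moveHead mv l w r s')

  Halted : Config m q → Set
  Halted c = step c ≡ nothing

  run : ℕ → Config m q → Config m q
  run zero    c = c
  run (suc t) c with step c
  ... | nothing = c
  ... | just c' = run t c'

  embed : List Sym → List (Γ m)
  embed = map (λ s → just (inj₁ s))

  initial : List Sym → Config m q
  initial []       = cfg start [] nothing []
  initial (x ∷ xs) = cfg start [] (just (inj₁ x)) (embed xs)

  -- the output is the word starting at the head, up to the first blank
  OutputIs : Config m q → List Sym → Set
  OutputIs (cfg _ _ h r) w =
    Σ (List (Γ m)) λ rest → (h ∷ r) ≡ embed w ++ rest ×
      (rest ≡ [] ⊎ Σ (List (Γ m)) λ rest' → rest ≡ nothing ∷ rest')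

  ComputesWithin : List Sym → ℕ → List Sym → Set
  ComputesWithin u T w = Halted (run T (initial u)) × OutputIs (run T (initial u)) w

-- An fpt-reduction from P to Q: a Turing machine M, computable functions
-- f, g (every Agda function ℕ → ℕ is computable) and a constant c such
-- that for every valid instance I of P, M on input encode I halts within
-- f(k)·|I|^c steps and outputs the encoding of a valid instance I' of Q
-- with param I' ≤ g(k) and  I ∈ P ⇔ I' ∈ Q.
FptReduction : ParamProblem → ParamProblem → Set
FptReduction P Q =
  Σ ℕ λ m → Σ ℕ λ q → Σ (TM m q) λ M →
  Σ (ℕ → ℕ) λ f → Σ ℕ λ c → Σ (ℕ → ℕ) λ g →
  ∀ (I : P.Instance) → P.Valid I →
    Σ Q.Instance λ I' →
      ComputesWithin M (P.encode I) (f (P.param I) * length (P.encode I) ^ c) (Q.encode I')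
      × Q.Valid I'
      × Q.param I' ≤ g (P.param I)
      × (P.Yes I ⇔ Q.Yes I')
  where
    module P = ParamProblem P
    module Q = ParamProblem Q

-- Rename the variables of φ injectively away from 0 and 2 and add the clause
-- x₀ ∨ x₂; the new instance is (φ′, x₀, k).  An unsatisfiable subset of φ
-- renames to a subset of φ′ entailing x₀.  Conversely, a subset ψ′ of φ′
-- entailing x₀ or ¬x₀ pulls back to a subset ψ of φ that is no larger, and a
-- model of ψ would extend to models of ψ′ with either value of x₀; so ψ is
-- unsatisfiable.  With the renaming v ↦ (binary code of v followed by 1), the
-- encoding of (φ′, x₀, k) is the image of that of (φ, k) under a
-- letter-to-word substitution, which a Turing machine computes in quadratic
-- time by moving the input letters one at a time past the end of the tape.

module Submission where

open import Defs
open import Data.Bool using (Bool; true; false)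
open import Data.Empty using (⊥-elim)
open import Data.Fin using (Fin; toℕ) renaming (zero to fzero; suc to fsuc)
open import Data.List using (List; []; _∷_; _++_; _∷ʳ_; _ʳ++_; length; map; concatMap; [_])
open import Data.List.Properties
  using (++-assoc; ++-identityʳ; ++-conicalʳ; ∷ʳ-injectiveʳ; concatMap-++; length-map; length-++; length-++-≤ʳ; map-++)
open import Data.List.Relation.Unary.All as All using (All; []; _∷_)
open import Data.List.Relation.Unary.All.Properties as All using ()
open import Data.List.Relation.Unary.Any as Any using (Any; here; there)
open import Data.List.Relation.Unary.Any.Properties as Any using ()
open import Data.List.Membership.Propositional using (_∈_)
open import Data.List.Membership.Propositional.Properties using (∈-map⁺; ∈-map⁻; ∈-++⁺ˡ; ∈-++⁻)
open import Data.Maybe using (Maybe; just; nothing) renaming (map to mapMaybe)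
open import Data.Nat using (ℕ; zero; suc; _+_; _*_; _^_; _∸_; _≤_; z≤n; s≤s)
open import Data.Nat.Binary as B using (ℕᵇ; 2[1+_]; 1+[2_])
open import Data.Nat.Binary.Properties using (fromℕ-toℕ; toℕ-fromℕ)
open import Data.Nat.Properties
  using ( +-comm; +-assoc; *-suc; ≤-refl; ≤-trans; ≤-reflexive; m≤m+n; m≤n⇒m≤1+n; n≤1+n; m+[n∸m]≡n
        ; +-mono-≤; +-monoˡ-≤; +-monoʳ-≤; *-monoʳ-≤; module ≤-Reasoning)
open import Data.Nat.Tactic.RingSolver using (solve-∀)
open import Data.Product using (Σ; _×_; _,_; map₁)
open import Data.Sum using (_⊎_; inj₁; inj₂; map₂)
open import Function using (_∘_; _$_)
open import Function.Bundles using (_⇔_; mk⇔; Equivalence)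
open import Function.Definitions using (Injective)
open import Relation.Binary.PropositionalEquality
  using (_≡_; _≢_; refl; sym; trans; cong; cong₂; subst; module ≡-Reasoning)

addTopDigit : ℕᵇ → ℕᵇ
addTopDigit B.zero   = 1+[2 B.zero ]
addTopDigit 2[1+ n ] = 2[1+ addTopDigit n ]
addTopDigit 1+[2 n ] = 1+[2 addTopDigit n ]

removeTopDigit : ℕᵇ → ℕᵇ
removeTopDigit B.zero             = B.zero
removeTopDigit 2[1+ n ]           = 2[1+ removeTopDigit n ]
removeTopDigit 1+[2 B.zero ]      = B.zero
removeTopDigit 1+[2 2[1+ n ] ]    = 1+[2 removeTopDigit 2[1+ n ] ]
removeTopDigit 1+[2 1+[2 n ] ]    = 1+[2 removeTopDigit 1+[2 n ] ]

removeTopDigit-addTopDigit : ∀ b → removeTopDigit (addTopDigit b) ≡ b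
removeTopDigit-addTopDigit B.zero           = refl
removeTopDigit-addTopDigit 2[1+ n ]         = cong 2[1+_] (removeTopDigit-addTopDigit n)
removeTopDigit-addTopDigit 1+[2 B.zero ]    = refl
removeTopDigit-addTopDigit 1+[2 2[1+ n ] ]  = cong 1+[2_] (removeTopDigit-addTopDigit 2[1+ n ])
removeTopDigit-addTopDigit 1+[2 1+[2 n ] ]  = cong 1+[2_] (removeTopDigit-addTopDigit 1+[2 n ])

bitsᵇ-addTopDigit : ∀ b → bitsᵇ (addTopDigit b) ≡ bitsᵇ b ∷ʳ b1
bitsᵇ-addTopDigit B.zero   = refl
bitsᵇ-addTopDigit 2[1+ n ] = cong (b0 ∷_) (bitsᵇ-addTopDigit n)
bitsᵇ-addTopDigit 1+[2 n ] = cong (b1 ∷_) (bitsᵇ-addTopDigit n)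

-- The code of relabel v is that of v followed by the digit 1, so relabel
-- misses 0 and 2, whose codes are [] and [b0].
relabel : ℕ → ℕ
relabel v = B.toℕ (addTopDigit (B.fromℕ v))

unrelabel : ℕ → ℕ
unrelabel n = B.toℕ (removeTopDigit (B.fromℕ n))

unrelabel-relabel : ∀ v → unrelabel (relabel v) ≡ v
unrelabel-relabel v = begin
  B.toℕ (removeTopDigit (B.fromℕ (B.toℕ (addTopDigit (B.fromℕ v)))))
    ≡⟨ cong (B.toℕ ∘ removeTopDigit) (fromℕ-toℕ (addTopDigit (B.fromℕ v))) ⟩
  B.toℕ (removeTopDigit (addTopDigit (B.fromℕ v)))
    ≡⟨ cong B.toℕ (removeTopDigit-addTopDigit (B.fromℕ v)) ⟩
  B.toℕ (B.fromℕ v)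
    ≡⟨ toℕ-fromℕ v ⟩
  v ∎
  where open ≡-Reasoning

relabel-injective : Injective _≡_ _≡_ relabel
relabel-injective {v} {w} eq = begin
  v                    ≡⟨ unrelabel-relabel v ⟨
  unrelabel (relabel v) ≡⟨ cong unrelabel eq ⟩
  unrelabel (relabel w) ≡⟨ unrelabel-relabel w ⟩
  w ∎
  where open ≡-Reasoning

encNat-relabel : ∀ v → encNat (relabel v) ≡ encNat v ∷ʳ b1
encNat-relabel v = trans (cong bitsᵇ (fromℕ-toℕ (addTopDigit (B.fromℕ v)))) (bitsᵇ-addTopDigit (B.fromℕ v))

relabel≢0 : ∀ v → relabel v ≢ 0
relabel≢0 v eq with () ← ++-conicalʳ (encNat v) [ b1 ] (trans (sym (encNat-relabel v)) (cong encNat eq))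

relabel≢2 : ∀ v → relabel v ≢ 2
relabel≢2 v eq with () ← ∷ʳ-injectiveʳ (encNat v) [] (trans (sym (encNat-relabel v)) (cong encNat eq))

renameLit : (ℕ → ℕ) → Literal → Literal
renameLit ρ (pos x) = pos (ρ x)
renameLit ρ (neg x) = neg (ρ x)

renameClause : (ℕ → ℕ) → Clause → Clause
renameClause ρ = map (renameLit ρ)

renameClause-wf : ∀ {ρ} → Injective _≡_ _≡_ ρ → ∀ {C} → ClauseWF C → ClauseWF (renameClause ρ C)
renameClause-wf {ρ} ρ-inj {C} wf x (p , n) with ∈-map⁻ (renameLit ρ) p | ∈-map⁻ (renameLit ρ) n
... | pos y , y∈C , refl | neg z , z∈C , eq = wf y (y∈C , subst (λ w → neg w ∈ C) (sym (ρ-inj (neg-injective eq))) z∈C)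
  where
  neg-injective : ∀ {a b} → neg a ≡ neg b → a ≡ b
  neg-injective refl = refl
... | pos _ , _ , _    | pos _ , _ , ()
... | neg _ , _ , ()   | _

litTrue-rename : ∀ {ρ a b} → (∀ v → b (ρ v) ≡ a v) → ∀ l → LitTrue b (renameLit ρ l) ⇔ LitTrue a l
litTrue-rename agree (pos v) = mk⇔ (trans (sym (agree v))) (trans (agree v))
litTrue-rename agree (neg v) = mk⇔ (trans (sym (agree v))) (trans (agree v))

satisfies-rename : ∀ {ρ a b} → (∀ v → b (ρ v) ≡ a v) → ∀ {ψ} →
                   Satisfies b (map (renameClause ρ) ψ) ⇔ Satisfies a ψ
satisfies-rename agree = mk⇔
  (All.map (Any.map (Equivalence.to (litTrue-rename agree _)) ∘ Any.map⁻) ∘ All.map⁻)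
  (All.map⁺ ∘ All.map (Any.map⁺ ∘ Any.map (Equivalence.from (litTrue-rename agree _))))

-- x₀ and x₂ are fresh; the guard clause makes x₀ a variable of the output
-- without forcing its value.
guard : Clause
guard = pos 0 ∷ pos 2 ∷ []

guard-wf : ClauseWF guard
guard-wf x (_ , here ())
guard-wf x (_ , there (here ()))
guard-wf x (_ , there (there ()))

reduce : CNF → CNF
reduce φ = map (renameClause relabel) φ ++ [ guard ]

reduce-wf : ∀ {φ} → CNFWF φ → CNFWF (reduce φ)
reduce-wf wf = All.++⁺ (All.map⁺ (All.map (renameClause-wf relabel-injective) wf)) (guard-wf ∷ [])

var₀-reduce : ∀ φ → VarOf 0 (reduce φ)
var₀-reduce φ = Any.++⁺ʳ (map (renameClause relabel) φ) (here (inj₁ (here refl)))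

extend : Assignment → Bool → Assignment
extend a t 0 = t
extend a t 2 = true
extend a t n = a (unrelabel n)

extend-relabel : ∀ a t v → extend a t (relabel v) ≡ a v
extend-relabel a t v = trans (away (relabel v) (relabel≢0 v) (relabel≢2 v)) (cong a (unrelabel-relabel v))
  where
  away : ∀ n → n ≢ 0 → n ≢ 2 → extend a t n ≡ a (unrelabel n)
  away 0 n≢0 _ = ⊥-elim (n≢0 refl)
  away 1 _ _ = refl
  away 2 _ n≢2 = ⊥-elim (n≢2 refl)
  away (suc (suc (suc n))) _ _ = refl

sublist-preimage : ∀ {A B : Set} (f : A → B) {xs : List A} {y : B} ys → All (_∈ map f xs ++ [ y ]) ys →
  Σ (List A) λ zs → All (_∈ xs) zs × length zs ≤ length ys × All (_∈ y ∷ map f zs) ys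
sublist-preimage f [] [] = [] , [] , z≤n , []
sublist-preimage f {xs} (c ∷ ys) (c∈ ∷ ys⊆) with sublist-preimage f ys ys⊆ | ∈-++⁻ (map f xs) c∈
... | zs , zs⊆ , ∣zs∣≤ , ys⊆′ | inj₁ c∈fxs with z , z∈xs , refl ← ∈-map⁻ f c∈fxs =
  z ∷ zs , z∈xs ∷ zs⊆ , s≤s ∣zs∣≤ , there (here refl) ∷ All.map ∈-insert ys⊆′
  where
  ∈-insert : ∀ {b} → b ∈ _ ∷ map f zs → b ∈ _ ∷ f z ∷ map f zs
  ∈-insert (here eq) = here eq
  ∈-insert (there b∈) = there (there b∈)
... | zs , zs⊆ , ∣zs∣≤ , ys⊆′ | inj₂ (here refl) = zs , zs⊆ , m≤n⇒m≤1+n ∣zs∣≤ , here refl ∷ ys⊆′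

unsat⇒backbone : ∀ φ k → HasSmallUnsatSubset φ k → IsKBackbone (reduce φ) 0 k
unsat⇒backbone φ k (ψ , (ψ⊆φ , ∣ψ∣≤k) , unsat) =
  map (renameClause relabel) ψ ,
  (All.map⁺ (All.map (∈-++⁺ˡ ∘ ∈-map⁺ (renameClause relabel)) ψ⊆φ) , ≤-trans (≤-reflexive (length-map _ ψ)) ∣ψ∣≤k) ,
  inj₁ λ a sat → ⊥-elim (unsat (a ∘ relabel) (Equivalence.to (satisfies-rename λ _ → refl) sat))

backbone⇒unsat : ∀ φ k → IsKBackbone (reduce φ) 0 k → HasSmallUnsatSubset φ k
backbone⇒unsat φ k (ψ′ , (ψ′⊆ , ∣ψ′∣≤k) , entails)
  with ψ , ψ⊆φ , ∣ψ∣≤ , ψ′⊆ψ ← sublist-preimage (renameClause relabel) ψ′ ψ′⊆ =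
  ψ , (ψ⊆φ , ≤-trans ∣ψ∣≤ ∣ψ′∣≤k) , unsat entails
  where
  extend-satisfies : ∀ a t → Satisfies a ψ → Satisfies (extend a t) ψ′
  extend-satisfies a t sat =
    All.map (All.lookup (there (here refl) ∷ Equivalence.from (satisfies-rename (extend-relabel a t)) sat)) ψ′⊆ψ
  unsat : EntailsPos ψ′ 0 ⊎ EntailsNeg ψ′ 0 → Unsatisfiable ψ
  unsat (inj₁ ⊨x₀)  a sat with () ← ⊨x₀ (extend a false) (extend-satisfies a false sat)
  unsat (inj₂ ⊨¬x₀) a sat with () ← ⊨¬x₀ (extend a true) (extend-satisfies a true sat)

reduce-correct : ∀ φ k → HasSmallUnsatSubset φ k ⇔ IsKBackbone (reduce φ) 0 k
reduce-correct φ k = mk⇔ (unsat⇒backbone φ k) (backbone⇒unsat φ k)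

image : Sym → List Sym
image litEnd   = b1 ∷ [ litEnd ]
image fieldEnd = encClause guard ++ fieldEnd ∷ encNat 0 ++ [ fieldEnd ]
image s        = [ s ]

concatMap-concatMap : ∀ {A A′ B C : Set} (h : B → List C) {f : A → List B} {f′ : A′ → List C} {g : A → A′} →
  (∀ x → concatMap h (f x) ≡ f′ (g x)) → ∀ xs → concatMap h (concatMap f xs) ≡ concatMap f′ (map g xs)
concatMap-concatMap h hf≗f′g []       = refl
concatMap-concatMap h {f} hf≗f′g (x ∷ xs) =
  trans (concatMap-++ h (f x) _) (cong₂ _++_ (hf≗f′g x) (concatMap-concatMap h hf≗f′g xs))

image-bitsᵇ : ∀ b → concatMap image (bitsᵇ b) ≡ bitsᵇ b
image-bitsᵇ B.zero   = refl
image-bitsᵇ 2[1+ n ] = cong (b0 ∷_) (image-bitsᵇ n)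
image-bitsᵇ 1+[2 n ] = cong (b1 ∷_) (image-bitsᵇ n)

image-encVar : ∀ v → concatMap image (encNat v ++ [ litEnd ]) ≡ encNat (relabel v) ++ [ litEnd ]
image-encVar v = begin
  concatMap image (encNat v ++ [ litEnd ])  ≡⟨ concatMap-++ image (encNat v) _ ⟩
  concatMap image (encNat v) ++ b1 ∷ [ litEnd ]  ≡⟨ cong (_++ b1 ∷ [ litEnd ]) (image-bitsᵇ (B.fromℕ v)) ⟩
  encNat v ++ b1 ∷ [ litEnd ]  ≡⟨ ++-assoc (encNat v) [ b1 ] _ ⟨
  (encNat v ∷ʳ b1) ++ [ litEnd ]  ≡⟨ cong (_++ [ litEnd ]) (encNat-relabel v) ⟨
  encNat (relabel v) ++ [ litEnd ] ∎
  where open ≡-Reasoning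

image-encLit : ∀ l → concatMap image (encLit l) ≡ encLit (renameLit relabel l)
image-encLit (pos v) = cong (b1 ∷_) (image-encVar v)
image-encLit (neg v) = cong (b0 ∷_) (image-encVar v)

image-encClause : ∀ C → concatMap image (encClause C) ≡ encClause (renameClause relabel C)
image-encClause C = trans (concatMap-++ image (concatMap encLit C) _)
                          (cong (_++ [ clauseEnd ]) (concatMap-concatMap image image-encLit C))

image-encode : ∀ φ k → concatMap image (encCNF φ ++ fieldEnd ∷ encNat k)
                     ≡ encCNF (reduce φ) ++ fieldEnd ∷ encNat 0 ++ fieldEnd ∷ encNat k
image-encode φ k = begin
  concatMap image (encCNF φ ++ fieldEnd ∷ encNat k)
    ≡⟨ concatMap-++ image (encCNF φ) _ ⟩
  concatMap image (encCNF φ) ++ image fieldEnd ++ concatMap image (encNat k)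
    ≡⟨ cong₂ (λ u w → u ++ image fieldEnd ++ w) (concatMap-concatMap image image-encClause φ) (image-bitsᵇ (B.fromℕ k)) ⟩
  encCNF φ′ ++ encClause guard ++ fieldEnd ∷ fieldEnd ∷ encNat k
    ≡⟨ ++-assoc (encCNF φ′) (encClause guard) _ ⟨
  (encCNF φ′ ++ encClause guard) ++ fieldEnd ∷ fieldEnd ∷ encNat k
    ≡⟨ cong (_++ fieldEnd ∷ fieldEnd ∷ encNat k) (concatMap-++ encClause φ′ [ guard ]) ⟨
  encCNF (reduce φ) ++ fieldEnd ∷ encNat 0 ++ fieldEnd ∷ encNat k ∎
  where
  open ≡-Reasoning
  φ′ = map (renameClause relabel) φ

firstCell : ∀ {m} → List (Γ m) → Γ m
firstCell []      = nothing
firstCell (g ∷ _) = g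

otherCells : ∀ {m} → List (Γ m) → List (Γ m)
otherCells []       = []
otherCells (_ ∷ gs) = gs

-- `at i ls r` has the head on the first cell of r, `atˡ i ls r` on the first
-- cell of ls; missing cells are blank.
at : ∀ {m q} → Fin q → List (Γ m) → List (Γ m) → Config m q
at i ls r = cfg i ls (firstCell r) (otherCells r)

atˡ : ∀ {m q} → Fin q → List (Γ m) → List (Γ m) → Config m q
atˡ i ls r = cfg i (otherCells ls) (firstCell ls) r

module Runs {m q} (M : TM m q) where
  open TM M using (δ)

  run-halted : ∀ {c} → Halted M c → ∀ t → run M t c ≡ c
  run-halted     halted zero    = refl
  run-halted {c} halted (suc t) with step M c
  run-halted     refl   (suc t) | nothing = refl

  run-+ : ∀ s t c → run M (s + t) c ≡ run M t (run M s c)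
  run-+ zero    t c = refl
  run-+ (suc s) t c with step M c in eq
  ... | nothing = sym (run-halted eq t)
  ... | just c′ = run-+ s t c′

  record Reaches (t : ℕ) (c c′ : Config m q) : Set where
    constructor reaches
    field runs : run M t c ≡ c′

  _⨾_ : ∀ {s t c c₁ c₂} → Reaches s c c₁ → Reaches t c₁ c₂ → Reaches (s + t) c c₂
  _⨾_ {s} {t} {c} (reaches p) (reaches q) = reaches (trans (run-+ s t c) (trans (cong (run M t) p) q))

  retime : ∀ {s t c c′} → s ≡ t → Reaches s c c′ → Reaches t c c′
  retime refl r = r

  module Reaches-Reasoning where
    infixr 2 _⟶⟨_⟩_ _≡⟨_⟩_
    infix 3 _∎

    _⟶⟨_⟩_ : ∀ c {c₁ c₂ s t} → Reaches s c c₁ → Reaches t c₁ c₂ → Reaches (s + t) c c₂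
    c ⟶⟨ r ⟩ r′ = r ⨾ r′

    _≡⟨_⟩_ : ∀ c {c₁ c₂ t} → c ≡ c₁ → Reaches t c₁ c₂ → Reaches t c c₂
    c ≡⟨ refl ⟩ r = r

    _∎ : ∀ c → Reaches 0 c c
    c ∎ = reaches refl

  step-reaches : ∀ {i j l h r w mv} → δ i h ≡ just (j , w , mv) → Reaches 1 (cfg i l h r) (moveHead M mv l w r j)
  step-reaches {i} {j} {l} {h} {r} {w} {mv} eq = reaches (run-1 (step-eq eq))
    where
    step-eq : δ i h ≡ just (j , w , mv) → step M (cfg i l h r) ≡ just (moveHead M mv l w r j)
    step-eq eq′ with δ i h
    step-eq refl | just _ = refl
    run-1 : ∀ {c c′} → step M c ≡ just c′ → run M 1 c ≡ c′
    run-1 {c} eq′ with step M c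
    run-1 refl | just _ = refl

  stepRight : ∀ {i j l h r w} → δ i h ≡ just (j , w , R) → Reaches 1 (cfg i l h r) (at j (w ∷ l) r)
  stepRight {r = []}    = step-reaches
  stepRight {r = _ ∷ _} = step-reaches

  stepLeft : ∀ {i j l h r w} → δ i h ≡ just (j , w , L) → Reaches 1 (cfg i l h r) (atˡ j l (w ∷ r))
  stepLeft {l = []}    = step-reaches
  stepLeft {l = _ ∷ _} = step-reaches

  SkipsRight SkipsLeft : Fin q → Γ m → Set
  SkipsRight i g = δ i g ≡ just (i , g , R)
  SkipsLeft  i g = δ i g ≡ just (i , g , L)

  walkRight : ∀ {i} Q ls r → All (SkipsRight i) Q → Reaches (length Q) (at i ls (Q ++ r)) (at i (Q ʳ++ ls) r)
  walkRight []      ls r []       = reaches refl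
  walkRight (g ∷ Q) ls r (s ∷ ss) = stepRight s ⨾ walkRight Q (g ∷ ls) r ss

  walkLeft : ∀ {i} Q ls r → All (SkipsLeft i) Q → Reaches (length Q) (atˡ i (Q ʳ++ ls) r) (atˡ i ls (Q ++ r))
  walkLeft []      ls r []       = reaches refl
  walkLeft (g ∷ Q) ls r (s ∷ ss) = retime (+-comm (length Q) 1) (walkLeft Q (g ∷ ls) r ss ⨾ stepLeft s)

  record ReachesWithin (t : ℕ) (c c′ : Config m q) : Set where
    constructor within
    field
      {steps} : ℕ
      steps≤  : steps ≤ t
      reach   : Reaches steps c c′

  _⨾≤_ : ∀ {s t c c₁ c₂} → Reaches s c c₁ → ReachesWithin t c₁ c₂ → ReachesWithin (s + t) c c₂
  _⨾≤_ {s} r (within ≤t r′) = within (+-monoʳ-≤ s ≤t) (r ⨾ r′)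

  weaken : ∀ {s t c c′} → s ≤ t → ReachesWithin s c c′ → ReachesWithin t c c′
  weaken s≤t (within ≤s r) = within (≤-trans ≤s s≤t) r

  computesWithin : ∀ {u t c w} → ReachesWithin t (initial M u) c → Halted M c → OutputIs M c w → ComputesWithin M u t w
  computesWithin {u} {t} {c} {w} (within {s} s≤t (reaches r)) halted output =
    subst (Halted M) (sym run-t) halted , subst (λ c′ → OutputIs M c′ w) (sym run-t) output
    where
    run-t : run M t (initial M u) ≡ c
    run-t = begin
      run M t (initial M u)                    ≡⟨ cong (λ t′ → run M t′ (initial M u)) (m+[n∸m]≡n s≤t) ⟨
      run M (s + (t ∸ s)) (initial M u)        ≡⟨ run-+ s (t ∸ s) (initial M u) ⟩
      run M (t ∸ s) (run M s (initial M u))    ≡⟨ cong (run M (t ∸ s)) r ⟩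
      run M (t ∸ s) c                          ≡⟨ run-halted halted (t ∸ s) ⟩
      c ∎
      where open ≡-Reasoning

G : Set
G = Γ 1

sy : Sym → G
sy s = just (inj₁ s)

-- separates the unread input (left) from the output written so far (right)
mark : G
mark = just (inj₂ fzero)

data State : Set where
  toEnd rewind consume return halt : State
  emit : ℕ → State

-- The emit states form a table: started at emitFrom s and followed along
-- emitNext, they write image s (image litEnd uses states 2–3, image
-- fieldEnd states 5–12).
emitFrom : Sym → ℕ
emitFrom b0        = 0
emitFrom b1        = 1
emitFrom litEnd    = 2
emitFrom clauseEnd = 4
emitFrom fieldEnd  = 5

emitSym : ℕ → Sym
emitSym 0  = b0
emitSym 1  = b1
emitSym 2  = b1
emitSym 3  = litEnd
emitSym 4  = clauseEnd
emitSym 5  = b1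
emitSym 6  = litEnd
emitSym 7  = b1
emitSym 8  = b0
emitSym 9  = litEnd
emitSym 10 = clauseEnd
emitSym _  = fieldEnd

emitNext : ℕ → State
emitNext 2  = emit 3
emitNext 5  = emit 6
emitNext 6  = emit 7
emitNext 7  = emit 8
emitNext 8  = emit 9
emitNext 9  = emit 10
emitNext 10 = emit 11
emitNext 11 = emit 12
emitNext _  = return

emitter : Sym → State
emitter s = emit (emitFrom s)

transition : State → G → Maybe (State × G × Move)
transition toEnd   nothing          = just (rewind , mark , L)
transition toEnd   g                = just (toEnd , g , R)
transition rewind  nothing          = just (consume , nothing , R)
transition rewind  g                = just (rewind , g , L)
transition consume (just (inj₁ s))  = just (emitter s , nothing , R)
transition consume (just (inj₂ _))  = just (halt , nothing , R)
transition consume nothing          = nothing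
transition return  (just (inj₂ _))  = just (rewind , mark , L)
transition return  g                = just (return , g , L)
transition halt    _                = nothing
transition (emit n) nothing         = just (emitNext n , sy (emitSym n) , R)
transition (emit n) g               = just (emit n , g , R)

clamp : (k : ℕ) → ℕ → Fin (suc k)
clamp k       zero    = fzero
clamp zero    (suc n) = fzero
clamp (suc k) (suc n) = fsuc (clamp k n)

-- clamp saturates, so ⌜_⌝ is injective only on the 18 states in use.
⌜_⌝ : State → Fin 18
⌜ toEnd ⌝   = clamp 17 0
⌜ rewind ⌝  = clamp 17 1
⌜ consume ⌝ = clamp 17 2
⌜ return ⌝  = clamp 17 3
⌜ halt ⌝    = clamp 17 4
⌜ emit n ⌝  = clamp 17 (5 + n)

decode : ℕ → State
decode 0 = toEnd
decode 1 = rewind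
decode 2 = consume
decode 3 = return
decode 4 = halt
decode (suc (suc (suc (suc (suc n))))) = emit n

copier : TM 1 18
copier = record
  { start = ⌜ toEnd ⌝
  ; δ     = λ i g → mapMaybe (map₁ ⌜_⌝) (transition (decode (toℕ i)) g)
  }

open Runs copier

walkRight-symbols : ∀ {i} → (∀ s → SkipsRight i (sy s)) → ∀ ws ls r →
  Reaches (length ws) (at i ls (map sy ws ++ r)) (at i (map sy ws ʳ++ ls) r)
walkRight-symbols skips ws ls r =
  retime (length-map sy ws) (walkRight (map sy ws) ls r (All.map⁺ (All.universal skips ws)))

walkLeft-symbols : ∀ {i} → (∀ s → SkipsLeft i (sy s)) → ∀ ws ls r →
  Reaches (length ws) (atˡ i (map sy ws ʳ++ ls) r) (atˡ i ls (map sy ws ++ r))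
walkLeft-symbols skips ws ls r =
  retime (length-map sy ws) (walkLeft (map sy ws) ls r (All.map⁺ (All.universal skips ws)))

toEnd-skips : ∀ s → SkipsRight ⌜ toEnd ⌝ (sy s)
toEnd-skips _ = refl

rewind-skips : ∀ s → SkipsLeft ⌜ rewind ⌝ (sy s)
rewind-skips _ = refl

return-skips : ∀ s → SkipsLeft ⌜ return ⌝ (sy s)
return-skips _ = refl

emitter-skips : ∀ x g → SkipsRight ⌜ emitter x ⌝ (just g)
emitter-skips b0        _ = refl
emitter-skips b1        _ = refl
emitter-skips litEnd    _ = refl
emitter-skips clauseEnd _ = refl
emitter-skips fieldEnd  _ = refl

emitter-writes-image : ∀ x ls →
  Reaches (length (image x)) (at ⌜ emitter x ⌝ ls []) (at ⌜ return ⌝ (map sy (image x) ʳ++ ls) [])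
emitter-writes-image b0        _ = reaches refl
emitter-writes-image b1        _ = reaches refl
emitter-writes-image litEnd    _ = reaches refl
emitter-writes-image clauseEnd _ = reaches refl
emitter-writes-image fieldEnd  _ = reaches refl

length-image≤8 : ∀ x → length (image x) ≤ 8
length-image≤8 b0        = s≤s z≤n
length-image≤8 b1        = s≤s z≤n
length-image≤8 litEnd    = s≤s (s≤s z≤n)
length-image≤8 clauseEnd = s≤s z≤n
length-image≤8 fieldEnd  = ≤-refl

-- From the second pass on, the cell after the output is an explicit blank.
BlankTail : List G → Set
BlankTail T = T ≡ [] ⊎ T ≡ [ nothing ]

at-blankTail : ∀ {i : Fin 18} {ls T} → BlankTail T → at i ls T ≡ at i ls []
at-blankTail (inj₁ refl) = refl
at-blankTail (inj₂ refl) = refl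

copier-setup : ∀ u → Reaches (2 * length u + 2) (initial copier u) (at ⌜ consume ⌝ [ nothing ] (map sy u ++ [ mark ]))
copier-setup u = retime (time (length u)) $
  initial copier u
    ≡⟨ initial-at u ⟩
  at ⌜ toEnd ⌝ [] (map sy u ++ [])
    ⟶⟨ walkRight-symbols toEnd-skips u [] [] ⟩
  at ⌜ toEnd ⌝ (map sy u ʳ++ []) []
    ⟶⟨ stepLeft refl ⟩
  atˡ ⌜ rewind ⌝ (map sy u ʳ++ []) [ mark ]
    ⟶⟨ walkLeft-symbols rewind-skips u [] [ mark ] ⟩
  atˡ ⌜ rewind ⌝ [] (map sy u ++ [ mark ])
    ⟶⟨ stepRight refl ⟩
  at ⌜ consume ⌝ [ nothing ] (map sy u ++ [ mark ]) ∎
  where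
  open Reaches-Reasoning
  initial-at : ∀ u → initial copier u ≡ at ⌜ toEnd ⌝ [] (map sy u ++ [])
  initial-at []      = refl
  initial-at (x ∷ u) = cong (λ r → cfg ⌜ toEnd ⌝ [] (sy x) r) (sym (++-identityʳ (map sy u)))
  time : ∀ n → n + (1 + (n + (1 + 0))) ≡ 2 * n + 2
  time = solve-∀

copy-symbol : ∀ x xs out ls T → BlankTail T →
  Reaches (2 * length xs + 2 * length out + 2 * length (image x) + 5)
    (at ⌜ consume ⌝ ls (map sy (x ∷ xs) ++ mark ∷ map sy out ++ T))
    (at ⌜ consume ⌝ (nothing ∷ ls) (map sy xs ++ mark ∷ map sy (out ++ image x) ++ [ nothing ]))
copy-symbol x xs out ls T blank = retime (time (length xs) (length out) (length (image x))) $
  at ⌜ consume ⌝ ls (sy x ∷ map sy xs ++ mark ∷ map sy out ++ T)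
    ⟶⟨ stepRight refl ⟩
  at e (nothing ∷ ls) (map sy xs ++ mark ∷ map sy out ++ T)
    ⟶⟨ walkRight-symbols (emitter-skips x ∘ inj₁) xs _ _ ⟩
  at e (map sy xs ʳ++ (nothing ∷ ls)) (mark ∷ map sy out ++ T)
    ⟶⟨ stepRight (emitter-skips x (inj₂ fzero)) ⟩
  at e (mark ∷ map sy xs ʳ++ (nothing ∷ ls)) (map sy out ++ T)
    ⟶⟨ walkRight-symbols (emitter-skips x ∘ inj₁) out _ _ ⟩
  at e (map sy out ʳ++ (mark ∷ map sy xs ʳ++ (nothing ∷ ls))) T
    ≡⟨ at-blankTail blank ⟩
  at e (map sy out ʳ++ (mark ∷ map sy xs ʳ++ (nothing ∷ ls))) []
    ⟶⟨ emitter-writes-image x _ ⟩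
  at ⌜ return ⌝ (map sy (image x) ʳ++ map sy out ʳ++ (mark ∷ map sy xs ʳ++ (nothing ∷ ls))) []
    ⟶⟨ stepLeft refl ⟩
  atˡ ⌜ return ⌝ (map sy (image x) ʳ++ map sy out ʳ++ (mark ∷ map sy xs ʳ++ (nothing ∷ ls))) [ nothing ]
    ⟶⟨ walkLeft-symbols return-skips (image x) _ _ ⟩
  atˡ ⌜ return ⌝ (map sy out ʳ++ (mark ∷ map sy xs ʳ++ (nothing ∷ ls))) (map sy (image x) ++ [ nothing ])
    ⟶⟨ walkLeft-symbols return-skips out _ _ ⟩
  atˡ ⌜ return ⌝ (mark ∷ map sy xs ʳ++ (nothing ∷ ls)) (map sy out ++ map sy (image x) ++ [ nothing ])
    ⟶⟨ stepLeft refl ⟩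
  atˡ ⌜ rewind ⌝ (map sy xs ʳ++ (nothing ∷ ls)) (mark ∷ map sy out ++ map sy (image x) ++ [ nothing ])
    ⟶⟨ walkLeft-symbols rewind-skips xs _ _ ⟩
  atˡ ⌜ rewind ⌝ (nothing ∷ ls) (map sy xs ++ mark ∷ map sy out ++ map sy (image x) ++ [ nothing ])
    ⟶⟨ stepRight refl ⟩
  at ⌜ consume ⌝ (nothing ∷ ls) (map sy xs ++ mark ∷ map sy out ++ map sy (image x) ++ [ nothing ])
    ≡⟨ cong (λ w → at ⌜ consume ⌝ (nothing ∷ ls) (map sy xs ++ mark ∷ w)) output ⟩
  at ⌜ consume ⌝ (nothing ∷ ls) (map sy xs ++ mark ∷ map sy (out ++ image x) ++ [ nothing ]) ∎
  where
  open Reaches-Reasoning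
  e = ⌜ emitter x ⌝
  output : map sy out ++ map sy (image x) ++ [ nothing ] ≡ map sy (out ++ image x) ++ [ nothing ]
  output = trans (sym (++-assoc (map sy out) _ _)) (cong (_++ [ nothing ]) (sym (map-++ sy out (image x))))
  time : ∀ a o h → 1 + (a + (1 + (o + (h + (1 + (h + (o + (1 + (a + (1 + 0)))))))))) ≡ 2 * a + 2 * o + 2 * h + 5
  time = solve-∀

copy-time-bound : ∀ {n a o h} → a ≤ n → o ≤ 8 * n → h ≤ 8 → 2 * a + 2 * o + 2 * h + 5 ≤ 18 * n + 21
copy-time-bound {n} a≤n o≤8n h≤8 =
  ≤-trans (+-monoˡ-≤ 5 (+-mono-≤ (+-mono-≤ (*-monoʳ-≤ 2 a≤n) (*-monoʳ-≤ 2 o≤8n)) (*-monoʳ-≤ 2 h≤8)))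
          (≤-reflexive (time n))
  where
  time : ∀ n → 2 * n + 2 * (8 * n) + 2 * 8 + 5 ≡ 18 * n + 21
  time = solve-∀

potential-step : ∀ x {xs out n} → length out + 8 * length (x ∷ xs) ≤ 8 * n →
                 length (out ++ image x) + 8 * length xs ≤ 8 * n
potential-step x {xs} {out} {n} potential = begin
  length (out ++ image x) + 8 * length xs        ≡⟨ cong (_+ 8 * length xs) (length-++ out) ⟩
  length out + length (image x) + 8 * length xs  ≤⟨ +-monoˡ-≤ (8 * length xs) (+-monoʳ-≤ (length out) (length-image≤8 x)) ⟩
  length out + 8 + 8 * length xs                 ≡⟨ +-assoc (length out) 8 _ ⟩
  length out + (8 + 8 * length xs)               ≡⟨ cong (length out +_) (*-suc 8 (length xs)) ⟨
  length out + 8 * suc (length xs)               ≤⟨ potential ⟩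
  8 * n                                          ∎
  where open ≤-Reasoning

-- The potential  length out + 8 · length rem  bounds the length of the output
-- written so far, hence the length of every pass over the tape.
copy-all : ∀ n rem out ls T → BlankTail T → length rem ≤ n → length out + 8 * length rem ≤ 8 * n →
  Σ (List G) λ ls′ → Σ (List G) λ T′ → BlankTail T′ ×
    ReachesWithin (length rem * (18 * n + 21) + 1)
      (at ⌜ consume ⌝ ls (map sy rem ++ mark ∷ map sy out ++ T))
      (at ⌜ halt ⌝ ls′ (map sy (out ++ concatMap image rem) ++ T′))
copy-all n [] out ls T blank _ _ = nothing ∷ ls , T , blank , within ≤-refl (
  at ⌜ consume ⌝ ls (mark ∷ map sy out ++ T)
    ⟶⟨ stepRight refl ⟩
  at ⌜ halt ⌝ (nothing ∷ ls) (map sy out ++ T)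
    ≡⟨ cong (λ w → at ⌜ halt ⌝ (nothing ∷ ls) (map sy w ++ T)) (sym (++-identityʳ out)) ⟩
  at ⌜ halt ⌝ (nothing ∷ ls) (map sy (out ++ []) ++ T) ∎)
  where open Reaches-Reasoning
copy-all n (x ∷ xs) out ls T blank ∣rem∣≤n potential
  with ls′ , T′ , blank′ , rest ← copy-all n xs (out ++ image x) (nothing ∷ ls) [ nothing ] (inj₂ refl)
                                     (≤-trans (n≤1+n (length xs)) ∣rem∣≤n)
                                     (potential-step x {xs} {out} {n} potential)
  = ls′ , T′ , blank′ , weaken time≤ (copy-symbol x xs out ls T blank ⨾≤ rest′)
  where
  B = 18 * n + 21
  rest′ : ReachesWithin (length xs * B + 1)
            (at ⌜ consume ⌝ (nothing ∷ ls) (map sy xs ++ mark ∷ map sy (out ++ image x) ++ [ nothing ]))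
            (at ⌜ halt ⌝ ls′ (map sy (out ++ concatMap image (x ∷ xs)) ++ T′))
  rest′ = subst (λ w → ReachesWithin (length xs * B + 1) start (at ⌜ halt ⌝ ls′ (map sy w ++ T′)))
                (++-assoc out (image x) (concatMap image xs)) rest
    where start = at ⌜ consume ⌝ (nothing ∷ ls) (map sy xs ++ mark ∷ map sy (out ++ image x) ++ [ nothing ])
  time≤ : 2 * length xs + 2 * length out + 2 * length (image x) + 5 + (length xs * B + 1) ≤ suc (length xs) * B + 1
  time≤ = ≤-trans (+-monoˡ-≤ (length xs * B + 1)
                    (copy-time-bound (≤-trans (n≤1+n (length xs)) ∣rem∣≤n)
                                     (≤-trans (m≤m+n (length out) (8 * length (x ∷ xs))) potential)
                                     (length-image≤8 x)))
                  (≤-reflexive (sym (+-assoc B _ 1)))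

halt-output : ∀ {ls} w {T} → BlankTail T → OutputIs copier (at ⌜ halt ⌝ ls (map sy w ++ T)) w
halt-output []          (inj₁ refl) = [ nothing ] , refl , inj₂ ([] , refl)
halt-output []          (inj₂ refl) = [ nothing ] , refl , inj₂ ([] , refl)
halt-output (_ ∷ _) {T} blank       = T , refl , map₂ ([] ,_) blank

total-time-bound : ∀ {n} → 1 ≤ n → 2 * n + 2 + (n * (18 * n + 21) + 1) ≤ 44 * n ^ 2
total-time-bound {suc m} _ = ≤-trans (m≤m+n _ (26 * m * m + 29 * m)) (≤-reflexive (time m))
  where
  time : ∀ m → 2 * (1 + m) + 2 + ((1 + m) * (18 * (1 + m) + 21) + 1) + (26 * m * m + 29 * m)
             ≡ 44 * ((1 + m) * ((1 + m) * 1))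
  time = solve-∀

copier-computes : ∀ u → 1 ≤ length u → ComputesWithin copier u (44 * length u ^ 2) (concatMap image u)
copier-computes u 1≤∣u∣
  with ls′ , T′ , blank , copying ← copy-all (length u) u [] [ nothing ] [] (inj₁ refl) ≤-refl ≤-refl
  = computesWithin (weaken (total-time-bound 1≤∣u∣) (copier-setup u ⨾≤ copying)) refl
                   (halt-output {ls′} (concatMap image u) blank)

lemma1 : FptReduction SUS LocalBackbone
lemma1 = 1 , 18 , copier , (λ _ → 44) , 2 , (λ k → k) , λ where
  (φ , k) (wf , 1≤k) →
    let u = encCNF φ ++ fieldEnd ∷ encNat k in
    (reduce φ , 0 , k) ,
    subst (ComputesWithin copier u (44 * length u ^ 2)) (image-encode φ k)
          (copier-computes u (≤-trans (s≤s z≤n) (length-++-≤ʳ (fieldEnd ∷ encNat k) {encCNF φ}))) ,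
    (reduce-wf wf , var₀-reduce φ , 1≤k) ,
    ≤-refl ,
    reduce-correct φ k
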